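{- For $n\ge1$, \[\sum_f u^{\mathrm{lucky}\,f}=-P_n(1,u,-u),\] where the sum is over all prime parking functions $f$ on $[n]$.
   Context: Given $f:[n]\to[n+1]$ (car $z$ prefers space $f(z)$), cars $1,\dots,n$ arrive in increasing order; car $z$ parks in the smallest unoccupied space $s$ with $f(z)\le s\le n$, if one exists. $f$ is a parking function if all cars park (equivalently, with $B_i=f^{ -1}(i)$, $|B_1|+\dots+|B_i|\ge i$ for all $i$). A parking function $f$ on $[n]$ is prime if $|B_1|+\dots+|B_i|>i$ for all $1\le i<n$. A car is lucky if it parks in its preferred space; $\mathrm{lucky}\,f$ is the number of lucky cars. $P_n(a,b,c)=c\prod_{i=1}^{n-1}(ia+(n-i)b+c)$. -}

module Defs where

open import Data.Bool using (Bool; true; false; _∧_; if_then_else_)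
open import Data.Nat as ℕ using (ℕ; zero; suc; _∸_; _≡ᵇ_; _≤ᵇ_; _<ᵇ_)
open import Data.List using (List; []; _∷_; map; filter; foldr; concatMap; applyUpTo; length)
open import Data.Bool.ListAction using (any; all)
open import Data.Maybe using (Maybe; just; nothing)
open import Data.Integer as ℤ using (ℤ; +_)
open import Relation.Nullary.Decidable using (T?)

-- Convention: spaces and preferences are natural numbers; cars are the
-- positions 1..n of a list, car z's preference f(z) being the z-th entry.

range : ℕ → ℕ → List ℕ
range a b = applyUpTo (λ k → a ℕ.+ k) (suc b ∸ a)

-- All functions f : [n] → [n+1], as lists (f(1), ..., f(n)) of length n.
seqs : ℕ → ℕ → List (List ℕ)
seqs zero    m = [] ∷ []
seqs (suc k) m = concatMap (λ a → map (a ∷_) (seqs k m)) (range 1 m)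

prefs : ℕ → List (List ℕ)
prefs n = seqs n (suc n)

elemᵇ : ℕ → List ℕ → Bool
elemᵇ s occ = any (s ≡ᵇ_) occ

spot : ℕ → List ℕ → ℕ → Maybe ℕ
spot n occ p with filter (λ s → T? (if elemᵇ s occ then false else true)) (range p n)
... | []    = nothing
... | s ∷ _ = just s

allParkFrom : ℕ → List ℕ → List ℕ → Bool
allParkFrom n occ []       = true
allParkFrom n occ (p ∷ ps) with spot n occ p
... | nothing = false
... | just s  = allParkFrom n (s ∷ occ) ps

luckyFrom : ℕ → List ℕ → List ℕ → ℕ
luckyFrom n occ []       = 0
luckyFrom n occ (p ∷ ps) with spot n occ p
... | nothing = luckyFrom n occ ps
... | just s  = (if s ≡ᵇ p then 1 else 0) ℕ.+ luckyFrom n (s ∷ occ) ps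

isParking : ℕ → List ℕ → Bool
isParking n f = allParkFrom n [] f

lucky : ℕ → List ℕ → ℕ
lucky n f = luckyFrom n [] f

-- |B_1| + ... + |B_i| = #{ z : f(z) ≤ i }
cumB : List ℕ → ℕ → ℕ
cumB f i = length (filter (λ a → T? (a ≤ᵇ i)) f)

isPrime : ℕ → List ℕ → Bool
isPrime n f = isParking n f ∧ all (λ i → i <ᵇ cumB f i) (range 1 (n ∸ 1))

productℤ : List ℤ → ℤ
productℤ = foldr ℤ._*_ (+ 1)

sumℤ : List ℤ → ℤ
sumℤ = foldr ℤ._+_ (+ 0)

P : ℕ → ℤ → ℤ → ℤ → ℤ
P n a b c = c ℤ.* productℤ (map (λ i → (+ i) ℤ.* a ℤ.+ (+ (n ∸ i)) ℤ.* b ℤ.+ c) (range 1 (n ∸ 1)))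

luckyGF : ℕ → ℤ → ℤ
luckyGF n u = sumℤ (map (λ f → u ℤ.^ lucky n f) (filter (λ f → T? (isPrime n f)) (prefs n)))

{-# OPTIONS --safe #-}

-- Put m = n − 1. A prime parking function takes values in 1, …, m, and for it parking on
-- the n spots behaves like circular parking on m spots: each of the first m cars finds a
-- vacant spot in 1, …, m without wrapping around, and the last car finds all of 1, …, m
-- occupied, so it is unlucky in both models. Circular parking commutes with rotating all
-- preferences, so its lucky statistic is rotation invariant, and by the cycle lemma exactly
-- one of the m rotations of any word in [m]^n is prime. Hence m times the sum equals the sum
-- of u^(circular lucky) over all words, which factors car by car: a car arriving when v spots
-- are vacant is lucky for v of its m preferences, contributing (m − v) + v·u. The factor for
-- v = m is m·u, and dividing by m leaves u ∏_{i=1}^{m} (i + (m − i)·u).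

module Submission where

open import Defs
open import Data.Bool using (Bool; true; false; not; T; _∧_; if_then_else_)
open import Data.Bool.ListAction using (all)
open import Data.Bool.Properties using (∧-conicalʳ; ∧-zeroʳ)
open import Data.Empty using (⊥-elim)
open import Data.Integer as ℤ using (ℤ; +_; -_)
import Data.Integer.Properties as ℤ
open import Data.Integer.Solver using (module +-*-Solver)
open import Data.List using (List; []; _∷_; _++_; [_]; map; filter; length; applyUpTo; upTo; concatMap)
open import Data.List.Properties
  using (applyUpTo-∷ʳ; map-cong; map-cong-local; map-upTo; map-∘; map-id; map-applyUpTo)
open import Data.List.Relation.Unary.All as All using (All; []; _∷_)
open import Data.List.Relation.Unary.All.Properties
  using (applyUpTo⁺₁; applyUpTo⁻; all⁺; all⁻; map⁺; All¬⇒¬Any)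
open import Data.List.Relation.Unary.Any using (Any; here; there)
open import Data.Maybe as Maybe using (Maybe; just; nothing; maybe′)
open import Data.Nat
  using (ℕ; NonZero; >-nonZero⁻¹; zero; suc; _+_; _∸_; _≥_; _≤_; _<_; z≤n; s≤s; s≤s⁻¹;
         _≤‴_; ≤‴-refl; ≤‴-step; _≡ᵇ_; _≤ᵇ_; _<ᵇ_)
open import Data.Nat.GeneralisedArithmetic using (iterate)
open import Data.Nat.Properties
open import Data.Product using (_×_; _,_; proj₁; proj₂; ∃-syntax)
open import Data.Sum using (_⊎_; inj₁; inj₂)
open import Function using (_∘_)
open import Relation.Binary.PropositionalEquality hiding ([_])
open import Relation.Nullary using (¬_; yes; no)
open import Relation.Nullary.Decidable using (T?)
open import Relation.Nullary.Reflects using (Reflects; ofʸ; ofⁿ; det; fromEquivalence; invert)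

open import Algebra.Properties.CommutativeSemigroup +-commutativeSemigroup using (interchange)
import Algebra.Properties.CommutativeSemigroup ℤ.+-commutativeSemigroup as ℤ+

private
  variable
    a b c d i j m n p q r s t x y : ℕ

≤ᵇ-true : ∀ {m n} → m ≤ n → (m ≤ᵇ n) ≡ true
≤ᵇ-true {m} {n} h = det (≤ᵇ-reflects-≤ m n) (ofʸ h)

≤ᵇ-false : ∀ {m n} → n < m → (m ≤ᵇ n) ≡ false
≤ᵇ-false {m} {n} h = det (≤ᵇ-reflects-≤ m n) (ofⁿ (<⇒≱ h))

≤ᵇ-≡ : (a ≤ b → c ≤ d) → (c ≤ d → a ≤ b) → (a ≤ᵇ b) ≡ (c ≤ᵇ d)
≤ᵇ-≡ {a} {b} {c} {d} to from =
  det (≤ᵇ-reflects-≤ a b) (fromEquivalence (from ∘ ≤ᵇ⇒≤ c d) (≤⇒≤ᵇ ∘ to))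

<ᵇ-true : ∀ {m n} → m < n → (m <ᵇ n) ≡ true
<ᵇ-true {m} {n} h = det (<ᵇ-reflects-< m n) (ofʸ h)

<ᵇ-false : ∀ {m n} → n ≤ m → (m <ᵇ n) ≡ false
<ᵇ-false {m} {n} h = det (<ᵇ-reflects-< m n) (ofⁿ (≤⇒≯ h))

≡ᵇ-reflects-≡ : ∀ m n → Reflects (m ≡ n) (m ≡ᵇ n)
≡ᵇ-reflects-≡ m n = fromEquivalence (≡ᵇ⇒≡ m n) (≡⇒≡ᵇ m n)

≡ᵇ-true : ∀ {m n} → m ≡ n → (m ≡ᵇ n) ≡ true
≡ᵇ-true {m} {n} h = det (≡ᵇ-reflects-≡ m n) (ofʸ h)

≡ᵇ-false : ∀ {m n} → m ≢ n → (m ≡ᵇ n) ≡ false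
≡ᵇ-false {m} {n} h = det (≡ᵇ-reflects-≡ m n) (ofⁿ h)

𝟙 : Bool → ℕ
𝟙 true  = 1
𝟙 false = 0

𝟙≤1 : ∀ β → 𝟙 β ≤ 1
𝟙≤1 true  = ≤-refl
𝟙≤1 false = z≤n

length≡𝟙 : ∀ {A : Set} (xs : List A) β → suc (length xs) ≡ 𝟙 β → xs ≡ [] × β ≡ true
length≡𝟙 [] true _ = refl , refl

count : (ℕ → Bool) → List ℕ → ℕ
count β []       = 0
count β (x ∷ xs) = 𝟙 (β x) + count β xs

length-filter≡count : ∀ β xs → length (filter (λ a → T? (β a)) xs) ≡ count β xs
length-filter≡count β []       = refl
length-filter≡count β (x ∷ xs) with β x
... | true  = cong suc (length-filter≡count β xs)
... | false = length-filter≡count β xs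

count≤length : ∀ β xs → count β xs ≤ length xs
count≤length β []       = z≤n
count≤length β (x ∷ xs) with β x
... | true  = s≤s (count≤length β xs)
... | false = m≤n⇒m≤1+n (count≤length β xs)

length≤count⇒all : ∀ β xs → length xs ≤ count β xs → All (T ∘ β) xs
length≤count⇒all β []       _ = []
length≤count⇒all β (x ∷ xs) h with β x in eq
... | true  = subst T (sym eq) _ ∷ length≤count⇒all β xs (s≤s⁻¹ h)
... | false = ⊥-elim (<⇒≱ h (count≤length β xs))

count-none : ∀ β xs → All (λ x → β x ≡ false) xs → count β xs ≡ 0
count-none β []       []        = refl
count-none β (x ∷ xs) (px ∷ pxs) rewrite px = count-none β xs pxs

count-all : ∀ β xs → All (λ x → β x ≡ true) xs → count β xs ≡ length xs
count-all β []       []        = refl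
count-all β (x ∷ xs) (px ∷ pxs) rewrite px = cong suc (count-all β xs pxs)

count-map : ∀ β (f : ℕ → ℕ) xs → count β (map f xs) ≡ count (β ∘ f) xs
count-map β f []       = refl
count-map β f (x ∷ xs) = cong (_+_ (𝟙 (β (f x)))) (count-map β f xs)

count-+-pointwise : ∀ {P : ℕ → Set} (β₁ β₂ β₃ β₄ : ℕ → Bool) xs → All P xs →
  (∀ {x} → P x → 𝟙 (β₁ x) + 𝟙 (β₂ x) ≡ 𝟙 (β₃ x) + 𝟙 (β₄ x)) →
  count β₁ xs + count β₂ xs ≡ count β₃ xs + count β₄ xs
count-+-pointwise β₁ β₂ β₃ β₄ []       []         h = refl
count-+-pointwise β₁ β₂ β₃ β₄ (x ∷ xs) (px ∷ pxs) h =
  begin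
    (𝟙 (β₁ x) + count β₁ xs) + (𝟙 (β₂ x) + count β₂ xs)
  ≡⟨ interchange (𝟙 (β₁ x)) _ _ _ ⟩
    (𝟙 (β₁ x) + 𝟙 (β₂ x)) + (count β₁ xs + count β₂ xs)
  ≡⟨ cong₂ _+_ (h px) (count-+-pointwise β₁ β₂ β₃ β₄ xs pxs h) ⟩
    (𝟙 (β₃ x) + 𝟙 (β₄ x)) + (count β₃ xs + count β₄ xs)
  ≡⟨ interchange (𝟙 (β₃ x)) _ _ _ ⟩
    (𝟙 (β₃ x) + count β₃ xs) + (𝟙 (β₄ x) + count β₄ xs)
  ∎
  where open ≡-Reasoning

applyUpTo-cong : ∀ {f g : ℕ → ℕ} n → (∀ i → f i ≡ g i) → applyUpTo f n ≡ applyUpTo g n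
applyUpTo-cong {f} {g} n h =
  trans (sym (map-upTo f n)) (trans (map-cong h (upTo n)) (map-upTo g n))

range-cons : p ≤ n → range p n ≡ p ∷ range (suc p) n
range-cons {p} {n} h rewrite +-∸-assoc 1 h =
  cong₂ _∷_ (+-identityʳ p) (applyUpTo-cong (n ∸ p) (+-suc p))

range-snoc : ∀ m → range 1 (suc m) ≡ range 1 m ++ [ suc m ]
range-snoc m = sym (applyUpTo-∷ʳ suc m)

All-range⁺ : ∀ {P : ℕ → Set} m → (∀ {i} → 1 ≤ i → i ≤ m → P i) → All P (range 1 m)
All-range⁺ m h = applyUpTo⁺₁ suc m (h (s≤s z≤n))

All-range⁻ : ∀ {P : ℕ → Set} m → All P (range 1 m) → ∀ {i} → 1 ≤ i → i ≤ m → P i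
All-range⁻ m h {suc i} _ i<m = applyUpTo⁻ suc m h i<m

sum-map-++ : ∀ {A : Set} (f : A → ℤ) xs ys →
  sumℤ (map f (xs ++ ys)) ≡ sumℤ (map f xs) ℤ.+ sumℤ (map f ys)
sum-map-++ f []       ys = sym (ℤ.+-identityˡ _)
sum-map-++ f (x ∷ xs) ys =
  trans (cong (ℤ._+_ (f x)) (sum-map-++ f xs ys)) (sym (ℤ.+-assoc (f x) _ _))

sum-map-zero : ∀ {A : Set} (f : A → ℤ) xs → (∀ x → f x ≡ + 0) → sumℤ (map f xs) ≡ + 0
sum-map-zero f []       h = refl
sum-map-zero f (x ∷ xs) h rewrite h x = trans (ℤ.+-identityˡ _) (sum-map-zero f xs h)

sum-map-*ˡ : ∀ {A : Set} c (f : A → ℤ) xs →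
  sumℤ (map (λ x → c ℤ.* f x) xs) ≡ c ℤ.* sumℤ (map f xs)
sum-map-*ˡ c f []       = sym (ℤ.*-zeroʳ c)
sum-map-*ˡ c f (x ∷ xs) =
  trans (cong (ℤ._+_ (c ℤ.* f x)) (sum-map-*ˡ c f xs)) (sym (ℤ.*-distribˡ-+ c (f x) _))

sum-map-*ʳ : ∀ {A : Set} (f : A → ℤ) c xs →
  sumℤ (map (λ x → f x ℤ.* c) xs) ≡ sumℤ (map f xs) ℤ.* c
sum-map-*ʳ f c []       = sym (ℤ.*-zeroˡ c)
sum-map-*ʳ f c (x ∷ xs) =
  trans (cong (ℤ._+_ (f x ℤ.* c)) (sum-map-*ʳ f c xs)) (sym (ℤ.*-distribʳ-+ c (f x) _))

sum-map-+ : ∀ {A : Set} (f g : A → ℤ) xs →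
  sumℤ (map (λ x → f x ℤ.+ g x) xs) ≡ sumℤ (map f xs) ℤ.+ sumℤ (map g xs)
sum-map-+ f g []       = refl
sum-map-+ f g (x ∷ xs) =
  trans (cong (ℤ._+_ (f x ℤ.+ g x)) (sum-map-+ f g xs)) (ℤ+.interchange (f x) (g x) _ _)

sum-map-filter : ∀ {A : Set} (P : A → Bool) (f : A → ℤ) xs →
  sumℤ (map f (filter (λ x → T? (P x)) xs)) ≡ sumℤ (map (λ x → if P x then f x else + 0) xs)
sum-map-filter P f []       = refl
sum-map-filter P f (x ∷ xs) with P x
... | true  = cong (ℤ._+_ (f x)) (sum-map-filter P f xs)
... | false = trans (sum-map-filter P f xs) (sym (ℤ.+-identityˡ _))

sumRange : ℕ → (ℕ → ℤ) → ℤ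
sumRange m f = sumℤ (map f (range 1 m))

sumRange-cong : ∀ m {f g : ℕ → ℤ} → (∀ {a} → 1 ≤ a → a ≤ m → f a ≡ g a) →
  sumRange m f ≡ sumRange m g
sumRange-cong m h = cong sumℤ (map-cong-local (All-range⁺ m h))

sumRange-suc : ∀ m (f : ℕ → ℤ) → sumRange (suc m) f ≡ sumRange m f ℤ.+ f (suc m)
sumRange-suc m f =
  trans (cong (sumℤ ∘ map f) (range-snoc m))
        (trans (sum-map-++ f (range 1 m) [ suc m ]) (cong (ℤ._+_ (sumRange m f)) (ℤ.+-identityʳ (f (suc m)))))

sumRange-vanishing : ∀ {f : ℕ → ℤ} → m ≤ n → (∀ {a} → m < a → a ≤ n → f a ≡ + 0) →
  sumRange n f ≡ sumRange m f
sumRange-vanishing {m} {zero}  z≤n _ = refl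
sumRange-vanishing {m} {suc n} {f} m≤1+n h with m ≟ suc n
... | yes refl = refl
... | no  m≢  =
  begin
    sumRange (suc n) f            ≡⟨ sumRange-suc n f ⟩
    sumRange n f ℤ.+ f (suc n)    ≡⟨ cong₂ ℤ._+_ (sumRange-vanishing m≤n (λ m<a a≤n → h m<a (m≤n⇒m≤1+n a≤n)))
                                                (h (s≤s m≤n) ≤-refl) ⟩
    sumRange m f ℤ.+ + 0          ≡⟨ ℤ.+-identityʳ _ ⟩
    sumRange m f                  ∎
  where
    open ≡-Reasoning
    m≤n : m ≤ n
    m≤n = s≤s⁻¹ (≤∧≢⇒< m≤1+n m≢)

sumWords : ℕ → ℕ → (List ℕ → ℤ) → ℤ
sumWords m zero    F = F []
sumWords m (suc k) F = sumRange m (λ a → sumWords m k (F ∘ (a ∷_)))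

sumWords-cong : ∀ m k {F G : List ℕ → ℤ} →
  (∀ w → All (λ x → 1 ≤ x × x ≤ m) w → length w ≡ k → F w ≡ G w) → sumWords m k F ≡ sumWords m k G
sumWords-cong m zero    h = h [] [] refl
sumWords-cong m (suc k) h =
  sumRange-cong m (λ 1≤a a≤m → sumWords-cong m k (λ w w∈ |w| → h _ ((1≤a , a≤m) ∷ w∈) (cong suc |w|)))

sumWords-zero : ∀ m k {F : List ℕ → ℤ} → (∀ w → length w ≡ k → F w ≡ + 0) → sumWords m k F ≡ + 0
sumWords-zero m zero    h = h [] refl
sumWords-zero m (suc k) h =
  sum-map-zero _ (range 1 m) (λ a → sumWords-zero m k (λ w |w| → h (a ∷ w) (cong suc |w|)))

sumWords-*ˡ : ∀ m k c (F : List ℕ → ℤ) → sumWords m k (λ w → c ℤ.* F w) ≡ c ℤ.* sumWords m k F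
sumWords-*ˡ m zero    c F = refl
sumWords-*ˡ m (suc k) c F =
  trans (sumRange-cong m (λ {a} _ _ → sumWords-*ˡ m k c (F ∘ (a ∷_))))
        (sum-map-*ˡ c _ (range 1 m))

sumWords-+ : ∀ m k (F G : List ℕ → ℤ) →
  sumWords m k (λ w → F w ℤ.+ G w) ≡ sumWords m k F ℤ.+ sumWords m k G
sumWords-+ m zero    F G = refl
sumWords-+ m (suc k) F G =
  trans (sumRange-cong m (λ {a} _ _ → sumWords-+ m k (F ∘ (a ∷_)) (G ∘ (a ∷_))))
        (sum-map-+ _ _ (range 1 m))

sum-seqs : ∀ m k (F : List ℕ → ℤ) → sumℤ (map F (seqs k m)) ≡ sumWords m k F
sum-seqs m zero    F = ℤ.+-identityʳ (F [])
sum-seqs m (suc k) F = go (range 1 m)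
  where
    go : ∀ as → sumℤ (map F (concatMap (λ a → map (a ∷_) (seqs k m)) as)) ≡
                sumℤ (map (λ a → sumWords m k (F ∘ (a ∷_))) as)
    go []       = refl
    go (a ∷ as) =
      trans (sum-map-++ F (map (a ∷_) (seqs k m)) _)
            (cong₂ ℤ._+_ (trans (cong sumℤ (sym (map-∘ (seqs k m)))) (sum-seqs m k (F ∘ (a ∷_)))) (go as))

sumWords-restrict : ∀ {m n} k {F : List ℕ → ℤ} → m ≤ n →
  (∀ w → length w ≡ k → Any (m <_) w → F w ≡ + 0) → sumWords n k F ≡ sumWords m k F
sumWords-restrict zero    m≤n h = refl
sumWords-restrict {m} {n} (suc k) m≤n h =
  trans (sumRange-vanishing m≤n (λ m<a _ → sumWords-zero n k (λ w |w| → h _ (cong suc |w|) (here m<a))))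
        (sumRange-cong m (λ _ _ → sumWords-restrict k m≤n (λ w |w| big → h _ (cong suc |w|) (there big))))

sumWords-map : ∀ m k (g : ℕ → ℕ) → (∀ f → sumRange m (f ∘ g) ≡ sumRange m f) →
  ∀ F → sumWords m k (F ∘ map g) ≡ sumWords m k F
sumWords-map m zero    g h F = refl
sumWords-map m (suc k) g h F =
  trans (sumRange-cong m (λ {a} _ _ → sumWords-map m k g h (F ∘ (g a ∷_))))
        (h (λ b → sumWords m k (F ∘ (b ∷_))))

sumBelow : ℕ → (ℕ → ℤ) → ℤ
sumBelow zero    f = + 0
sumBelow (suc K) f = sumBelow K f ℤ.+ f K

sumBelow-const : ∀ K c → sumBelow K (λ _ → c) ≡ + K ℤ.* c
sumBelow-const zero    c = refl
sumBelow-const (suc K) c =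
  trans (cong (ℤ._+ c) (sumBelow-const K c)) (trans (ℤ.+-comm (+ K ℤ.* c) c) (sym (ℤ.suc-* (+ K) c)))

sumBelow-cong : ∀ K {f g : ℕ → ℤ} → (∀ r → f r ≡ g r) → sumBelow K f ≡ sumBelow K g
sumBelow-cong zero    h = refl
sumBelow-cong (suc K) h = cong₂ ℤ._+_ (sumBelow-cong K h) (h K)

sumBelow-vanishing : ∀ K {f : ℕ → ℤ} → (∀ {r} → r < K → f r ≡ + 0) → sumBelow K f ≡ + 0
sumBelow-vanishing zero    h = refl
sumBelow-vanishing (suc K) h rewrite h (n<1+n K) = trans (ℤ.+-identityʳ _) (sumBelow-vanishing K (h ∘ m<n⇒m<1+n))

sumBelow-single : ∀ K {f : ℕ → ℤ} r₀ → r₀ < K → (∀ {r} → r < K → r ≢ r₀ → f r ≡ + 0) →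
  sumBelow K f ≡ f r₀
sumBelow-single (suc K) {f} r₀ r₀<1+K h with r₀ ≟ K
... | yes refl =
  trans (cong (ℤ._+ f r₀) (sumBelow-vanishing K (λ r<K → h (m<n⇒m<1+n r<K) (<⇒≢ r<K)))) (ℤ.+-identityˡ _)
... | no  r₀≢K =
  trans (cong₂ ℤ._+_ (sumBelow-single K r₀ (≤∧≢⇒< (s≤s⁻¹ r₀<1+K) r₀≢K) (h ∘ m<n⇒m<1+n))
                     (h (n<1+n K) (r₀≢K ∘ sym)))
        (ℤ.+-identityʳ _)

sumWords-sumBelow : ∀ m k K (F : ℕ → List ℕ → ℤ) →
  sumWords m k (λ w → sumBelow K (λ r → F r w)) ≡ sumBelow K (λ r → sumWords m k (F r))
sumWords-sumBelow m k zero    F = sumWords-zero m k (λ _ _ → refl)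
sumWords-sumBelow m k (suc K) F =
  trans (sumWords-+ m k (λ w → sumBelow K (λ r → F r w)) (F K))
        (cong (ℤ._+ sumWords m k (F K)) (sumWords-sumBelow m k K F))

cumB-map : ∀ (h : ℕ → ℕ) f i → cumB (map h f) i ≡ count (λ a → h a ≤ᵇ i) f
cumB-map h f i = trans (length-filter≡count (_≤ᵇ i) (map h f)) (count-map (_≤ᵇ i) h f)

Exceeds : ℕ → List ℕ → Set
Exceeds m f = ∀ {i} → 1 ≤ i → i ≤ m → i < cumB f i

-- The second conjunct of isPrime (suc m) f.
exceedsᵇ : ℕ → List ℕ → Bool
exceedsᵇ m f = all (λ i → i <ᵇ cumB f i) (range 1 m)

exceedsᵇ-reflects : ∀ m f → Reflects (Exceeds m f) (exceedsᵇ m f)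
exceedsᵇ-reflects m f = fromEquivalence
  (λ holds {i} 1≤i i≤m → <ᵇ⇒< i (cumB f i) (All-range⁻ m (all⁺ _ (range 1 m) holds) 1≤i i≤m))
  (λ exceeds → all⁻ _ (All-range⁺ m (λ 1≤i i≤m → <⇒<ᵇ (exceeds 1≤i i≤m))))

exceedsᵇ⇒Exceeds : ∀ m f → exceedsᵇ m f ≡ true → Exceeds m f
exceedsᵇ⇒Exceeds m f holds = invert (subst (Reflects (Exceeds m f)) holds (exceedsᵇ-reflects m f))

exceedsᵇ-true : ∀ m f → Exceeds m f → exceedsᵇ m f ≡ true
exceedsᵇ-true m f exceeds = det (exceedsᵇ-reflects m f) (ofʸ exceeds)

exceedsᵇ-false : ∀ m f → ¬ Exceeds m f → exceedsᵇ m f ≡ false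
exceedsᵇ-false m f ¬exceeds = det (exceedsᵇ-reflects m f) (ofⁿ ¬exceeds)

-- Linear parking

Occupied Vacant : List ℕ → ℕ → Set
Occupied occ s = elemᵇ s occ ≡ true
Vacant   occ s = elemᵇ s occ ≡ false

isVacant : List ℕ → ℕ → Bool
isVacant occ s = not (elemᵇ s occ)

occupied⇒¬vacant : ∀ {occ} → Occupied occ s → ¬ Vacant occ s
occupied⇒¬vacant occupied vacant = subst T (trans (sym occupied) vacant) _

isVacant⇒Vacant : ∀ {occ} → isVacant occ s ≡ true → Vacant occ s
isVacant⇒Vacant {s} {occ} vacant with elemᵇ s occ
... | false = refl

vacant-∷⁻ : ∀ {occ} → Vacant (s ∷ occ) x → Vacant occ x
vacant-∷⁻ {s} {x} vacant with x ≡ᵇ s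
... | false = vacant

data FirstVacant (occ : List ℕ) : ℕ → ℕ → Set where
  here  : Vacant occ p → FirstVacant occ p p
  there : Occupied occ p → FirstVacant occ (suc p) s → FirstVacant occ p s

firstVacant-≤ : ∀ {occ} → FirstVacant occ p s → p ≤ s
firstVacant-≤ (here _)       = ≤-refl
firstVacant-≤ (there _ rest) = <⇒≤ (firstVacant-≤ rest)

firstVacant-vacant : ∀ {occ} → FirstVacant occ p s → Vacant occ s
firstVacant-vacant (here vacant)  = vacant
firstVacant-vacant (there _ rest) = firstVacant-vacant rest

firstVacant-before : ∀ {occ} → FirstVacant occ p s → p ≤ t → t < s → Occupied occ t
firstVacant-before (here _)                p≤t t<p = ⊥-elim (<⇒≱ t<p p≤t)
firstVacant-before {p} {t = t} (there occupied rest) p≤t t<s with p ≟ t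
... | yes refl = occupied
... | no  p≢t  = firstVacant-before rest (≤∧≢⇒< p≤t p≢t) t<s

firstVacant-≡ᵇ : ∀ {occ} → FirstVacant occ p s → (s ≡ᵇ p) ≡ isVacant occ p
firstVacant-≡ᵇ {p} (here vacant) rewrite vacant = ≡ᵇ-true {p} refl
firstVacant-≡ᵇ (there occupied rest) rewrite occupied = ≡ᵇ-false (<⇒≢ (firstVacant-≤ rest) ∘ sym)

firstVacant-after-full : ∀ {occ} → p ≤‴ s → (∀ {t} → p ≤ t → t < s → Occupied occ t) → Vacant occ s →
  FirstVacant occ p s
firstVacant-after-full ≤‴-refl          _    vacant = here vacant
firstVacant-after-full (≤‴-step 1+p≤s) full vacant =
  there (full ≤-refl (≤‴⇒≤ 1+p≤s)) (firstVacant-after-full 1+p≤s (full ∘ <⇒≤) vacant)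

firstVacant-or-full : ∀ occ m → p ≤‴ suc m →
  (∃[ s ] FirstVacant occ p s × s ≤ m) ⊎ (∀ {t} → p ≤ t → t ≤ m → Occupied occ t)
firstVacant-or-full occ m ≤‴-refl = inj₂ (λ p≤t t≤m → ⊥-elim (<⇒≱ (s≤s t≤m) p≤t))
firstVacant-or-full {p} occ m (≤‴-step 1+p≤1+m) with elemᵇ p occ in eq
... | false = inj₁ (p , here eq , s≤s⁻¹ (≤‴⇒≤ 1+p≤1+m))
... | true  with firstVacant-or-full occ m 1+p≤1+m
...   | inj₁ (s , rest , s≤m) = inj₁ (s , there eq rest , s≤m)
...   | inj₂ full              = inj₂ full′
  where
    full′ : ∀ {t} → p ≤ t → t ≤ m → Occupied occ t
    full′ {t} p≤t t≤m with p ≟ t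
    ... | yes refl = eq
    ... | no  p≢t  = full (≤∧≢⇒< p≤t p≢t) t≤m

spot-vacant : ∀ {occ} → p ≤ n → Vacant occ p → spot n occ p ≡ just p
spot-vacant {p} {n} p≤n vacant rewrite range-cons {p} {n} p≤n | vacant = refl

spot-occupied : ∀ {occ} → p ≤ n → Occupied occ p → spot n occ p ≡ spot n occ (suc p)
spot-occupied {p} {n} p≤n occupied rewrite range-cons {p} {n} p≤n | occupied = refl

spot-firstVacant : ∀ {occ} → FirstVacant occ p s → s ≤ n → spot n occ p ≡ just s
spot-firstVacant {occ = occ} (here vacant) s≤n = spot-vacant {occ = occ} s≤n vacant
spot-firstVacant {occ = occ} (there occupied rest) s≤n =
  trans (spot-occupied {occ = occ} (≤-trans (<⇒≤ (firstVacant-≤ rest)) s≤n) occupied) (spot-firstVacant rest s≤n)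

luckyFrom-firstVacant : ∀ {occ} ps → FirstVacant occ p s → s ≤ n →
  luckyFrom n occ (p ∷ ps) ≡ 𝟙 (isVacant occ p) + luckyFrom n (s ∷ occ) ps
luckyFrom-firstVacant {p} {s} {n} ps first s≤n
  rewrite spot-firstVacant {n = n} first s≤n | sym (firstVacant-≡ᵇ first) with s ≡ᵇ p
... | true  = refl
... | false = refl

allParkFrom-firstVacant : ∀ {occ} ps → FirstVacant occ p s → s ≤ n →
  allParkFrom n occ (p ∷ ps) ≡ allParkFrom n (s ∷ occ) ps
allParkFrom-firstVacant {n = n} ps first s≤n rewrite spot-firstVacant {n = n} first s≤n = refl

vacancies : List ℕ → ℕ → ℕ
vacancies occ zero    = 0
vacancies occ (suc q) = 𝟙 (isVacant occ (suc q)) + vacancies occ q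

vacancies≤ : ∀ occ q → vacancies occ q ≤ q
vacancies≤ occ zero    = z≤n
vacancies≤ occ (suc q) with isVacant occ (suc q)
... | true  = s≤s (vacancies≤ occ q)
... | false = m≤n⇒m≤1+n (vacancies≤ occ q)

vacancies-[] : ∀ q → vacancies [] q ≡ q
vacancies-[] zero    = refl
vacancies-[] (suc q) = cong suc (vacancies-[] q)

isVacant-∷ : ∀ occ → x ≢ s → isVacant (s ∷ occ) x ≡ isVacant occ x
isVacant-∷ occ x≢s rewrite ≡ᵇ-false x≢s = refl

vacancies-∷-< : ∀ occ → q < s → vacancies (s ∷ occ) q ≡ vacancies occ q
vacancies-∷-< {q = zero}  occ q<s = refl
vacancies-∷-< {q = suc q} occ q<s =
  cong₂ _+_ (cong 𝟙 (isVacant-∷ occ (<⇒≢ q<s))) (vacancies-∷-< occ (<⇒≤ q<s))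

vacancies-∷ : ∀ occ → 1 ≤ s → s ≤ q → Vacant occ s → suc (vacancies (s ∷ occ) q) ≡ vacancies occ q
vacancies-∷ {s = suc _} {q = zero} occ _ ()
vacancies-∷ {s} {suc q} occ 1≤s s≤1+q vacant with s ≟ suc q
... | yes refl rewrite ≡ᵇ-true {s} refl | vacant = cong suc (vacancies-∷-< {q = q} occ ≤-refl)
... | no  s≢   rewrite isVacant-∷ occ (s≢ ∘ sym) =
  trans (sym (+-suc _ _))
        (cong (_+_ (𝟙 (isVacant occ (suc q)))) (vacancies-∷ occ 1≤s (s≤s⁻¹ (≤∧≢⇒< s≤1+q s≢)) vacant))

vacancies-full : ∀ occ q → (∀ {x} → 1 ≤ x → x ≤ q → Occupied occ x) → vacancies occ q ≡ 0
vacancies-full occ zero    full = refl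
vacancies-full occ (suc q) full rewrite full (s≤s z≤n) ≤-refl =
  vacancies-full occ q (λ 1≤x x≤q → full 1≤x (m≤n⇒m≤1+n x≤q))

lastVacant : ∀ occ j → 1 ≤ vacancies occ j →
  ∃[ q ] 1 ≤ q × q ≤ j × Vacant occ q × vacancies occ q ≡ vacancies occ j
lastVacant occ (suc j) 1≤v with elemᵇ (suc j) occ in eq
... | false = suc j , s≤s z≤n , ≤-refl , eq , cong (λ β → 𝟙 (not β) + vacancies occ j) eq
... | true  with lastVacant occ j 1≤v
...   | q , 1≤q , q≤j , vacant , same = q , 1≤q , m≤n⇒m≤1+n q≤j , vacant , same

sumRange-vacant : ∀ u occ q →
  sumRange q (λ a → u ℤ.^ 𝟙 (isVacant occ a)) ≡ + (q ∸ vacancies occ q) ℤ.+ + vacancies occ q ℤ.* u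
sumRange-vacant u occ zero    = refl
sumRange-vacant u occ (suc q) =
  trans (sumRange-suc q _) (trans (cong (ℤ._+ u ℤ.^ 𝟙 (isVacant occ (suc q))) (sumRange-vacant u occ q)) step)
  where
    open +-*-Solver
    v : ℕ
    v = vacancies occ q
    step : + (q ∸ v) ℤ.+ + v ℤ.* u ℤ.+ u ℤ.^ 𝟙 (isVacant occ (suc q)) ≡
           + (suc q ∸ vacancies occ (suc q)) ℤ.+ + vacancies occ (suc q) ℤ.* u
    step with isVacant occ (suc q)
    ... | true  = solve 3 (λ a b c → a :+ b :* c :+ c :* con (+ 1) := a :+ (con (+ 1) :+ b) :* c) refl
                    (+ (q ∸ v)) (+ v) u
    ... | false rewrite +-∸-assoc 1 (vacancies≤ occ q) =
      solve 3 (λ a b c → a :+ b :* c :+ con (+ 1) := (con (+ 1) :+ a) :+ b :* c) refl (+ (q ∸ v)) (+ v) u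

-- Circular parking on the spots 1, …, m

module Circular (m : ℕ) where

  InRange : ℕ → Set
  InRange x = 1 ≤ x × x ≤ m

  next : ℕ → ℕ
  next x = if x <ᵇ m then suc x else 1

  rotate : ℕ → ℕ → ℕ
  rotate r x = iterate next x r

  next-< : x < m → next x ≡ suc x
  next-< x<m rewrite <ᵇ-true x<m = refl

  next-≥ : m ≤ x → next x ≡ 1
  next-≥ m≤x rewrite <ᵇ-false m≤x = refl

  next-inRange : InRange x → InRange (next x)
  next-inRange {x} (1≤x , x≤m) with x <? m
  ... | yes x<m rewrite next-< x<m        = s≤s z≤n , x<m
  ... | no  x≮m rewrite next-≥ (≮⇒≥ x≮m) = ≤-refl , ≤-trans 1≤x x≤m

  next-injective : InRange x → InRange y → next x ≡ next y → x ≡ y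
  next-injective {x} {y} (1≤x , x≤m) (1≤y , y≤m) eq with x <? m | y <? m
  ... | yes x<m | yes y<m = suc-injective (trans (sym (next-< x<m)) (trans eq (next-< y<m)))
  ... | yes x<m | no  y≮m = ⊥-elim (<⇒≢ (s≤s 1≤x) (trans (sym (next-≥ (≮⇒≥ y≮m))) (trans (sym eq) (next-< x<m))))
  ... | no  x≮m | yes y<m = ⊥-elim (<⇒≢ (s≤s 1≤y) (trans (sym (next-≥ (≮⇒≥ x≮m))) (trans eq (next-< y<m))))
  ... | no  x≮m | no  y≮m = trans (≤-antisym x≤m (≮⇒≥ x≮m)) (≤-antisym (≮⇒≥ y≮m) y≤m)

  rotate-inRange : ∀ r → InRange x → InRange (rotate r x)
  rotate-inRange zero    x∈ = x∈
  rotate-inRange (suc r) x∈ = rotate-inRange r (next-inRange x∈)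

  rotate-+ : ∀ r → x + r ≤ m → rotate r x ≡ x + r
  rotate-+ {x} zero    _        = sym (+-identityʳ x)
  rotate-+ {x} (suc r) x+1+r≤m =
    begin
      rotate r (next x) ≡⟨ cong (rotate r) (next-< x<m) ⟩
      rotate r (suc x)  ≡⟨ rotate-+ r 1+x+r≤m ⟩
      suc x + r         ≡⟨ sym (+-suc x r) ⟩
      x + suc r         ∎
    where
      open ≡-Reasoning
      1+x+r≤m : suc x + r ≤ m
      1+x+r≤m = subst (_≤ m) (+-suc x r) x+1+r≤m
      x<m : x < m
      x<m = ≤-trans (m≤m+n (suc x) r) 1+x+r≤m

  rotate-wrap : ∀ r → x ≤ m → r ≤ m → m < x + r → rotate r x ≡ x + r ∸ m
  rotate-wrap {x} zero    x≤m _     m<x+0 = ⊥-elim (<⇒≱ m<x+0 (≤-trans (≤-reflexive (+-identityʳ x)) x≤m))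
  rotate-wrap {x} (suc r) x≤m 1+r≤m m<x+1+r with x <? m
  ... | yes x<m = trans (cong (rotate r) (next-< x<m))
                        (trans (rotate-wrap r x<m (<⇒≤ 1+r≤m) (subst (m <_) (+-suc x r) m<x+1+r))
                               (cong (_∸ m) (sym (+-suc x r))))
  ... | no  x≮m rewrite ≤-antisym x≤m (≮⇒≥ x≮m) =
    trans (cong (rotate r) (next-≥ ≤-refl)) (trans (rotate-+ r 1+r≤m) (sym (m+n∸m≡n m (suc r))))

  rotate-reaches : InRange p → InRange x → ∃[ j ] j < m × rotate j p ≡ x
  rotate-reaches {p} {x} (1≤p , p≤m) (1≤x , x≤m) with p ≤? x
  ... | yes p≤x =
    x ∸ p , x∸p<m , trans (rotate-+ (x ∸ p) (≤-trans (≤-reflexive (m+[n∸m]≡n p≤x)) x≤m)) (m+[n∸m]≡n p≤x)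
    where
      x∸p<m : x ∸ p < m
      x∸p<m = <-≤-trans (∸-monoʳ-< 1≤p p≤x) x≤m
  ... | no  p≰x = j₀ , j₀<m , trans (rotate-wrap j₀ p≤m (<⇒≤ j₀<m) m<p+j₀) p+j₀∸m≡x
    where
      j₀ : ℕ
      j₀ = m ∸ p + x
      p+j₀≡m+x : p + j₀ ≡ m + x
      p+j₀≡m+x = trans (sym (+-assoc p (m ∸ p) x)) (cong (_+ x) (m+[n∸m]≡n p≤m))
      j₀<m : j₀ < m
      j₀<m = subst (j₀ <_) (m∸n+n≡m p≤m) (+-monoʳ-< (m ∸ p) (≰⇒> p≰x))
      m<p+j₀ : m < p + j₀
      m<p+j₀ = subst (m <_) (sym p+j₀≡m+x) (m<m+n m 1≤x)
      p+j₀∸m≡x : p + j₀ ∸ m ≡ x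
      p+j₀∸m≡x = trans (cong (_∸ m) p+j₀≡m+x) (m+n∸m≡n m x)

  search : ℕ → List ℕ → ℕ → Maybe ℕ
  search zero    occ p = nothing
  search (suc k) occ p = if elemᵇ p occ then search k occ (next p) else just p

  park : List ℕ → ℕ → List ℕ
  park occ p = maybe′ (_∷ occ) occ (search m occ p)

  circLucky : List ℕ → List ℕ → ℕ
  circLucky occ []       = 0
  circLucky occ (p ∷ ps) = 𝟙 (isVacant occ p) + circLucky (park occ p) ps

  search-just : ∀ k {occ} → search k occ p ≡ just s → ∃[ j ] rotate j p ≡ s × Vacant occ s
  search-just {p} (suc k) {occ} found with elemᵇ p occ in eq
  ... | true  with search-just k found
  ...   | j , reach , vacant = suc j , reach , vacant
  search-just {p} (suc k) {occ} refl | false = 0 , refl , eq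

  search-nothing : ∀ k {occ} → search k occ p ≡ nothing → ∀ {j} → j < k → Occupied occ (rotate j p)
  search-nothing {p} (suc k) {occ} eq {j} j<k with elemᵇ p occ in occupied | j
  ... | true | zero  = occupied
  ... | true | suc j = search-nothing k eq (s≤s⁻¹ j<k)

  search-firstVacant : ∀ k {occ} → FirstVacant occ p s → s ≤ m → s < p + k → search k occ p ≡ just s
  search-firstVacant {p} zero first s≤m s<p+0 =
    ⊥-elim (<⇒≱ s<p+0 (≤-trans (≤-reflexive (+-identityʳ p)) (firstVacant-≤ first)))
  search-firstVacant (suc k) (here vacant) s≤m _ rewrite vacant = refl
  search-firstVacant {p} {s} (suc k) (there occupied rest) s≤m s<p+1+k rewrite occupied =
    trans (cong (search k _) (next-< (<-≤-trans (firstVacant-≤ rest) s≤m)))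
          (search-firstVacant k rest s≤m (subst (s <_) (+-suc p k) s<p+1+k))

  park-firstVacant : ∀ {occ} → FirstVacant occ p s → 1 ≤ p → s ≤ m → park occ p ≡ s ∷ occ
  park-firstVacant {p} first 1≤p s≤m
    rewrite search-firstVacant m first s≤m (<-≤-trans (s≤s s≤m) (+-monoˡ-≤ m 1≤p)) = refl

  park-inRange : ∀ {occ} → InRange p → All InRange occ → All InRange (park occ p)
  park-inRange {p} {occ} p∈ occ∈ with search m occ p in eq
  ... | nothing = occ∈
  ... | just s with search-just m eq
  ...   | j , refl , _ = rotate-inRange j p∈ ∷ occ∈

  ≡ᵇ-next : InRange x → InRange y → (next x ≡ᵇ next y) ≡ (x ≡ᵇ y)
  ≡ᵇ-next {x} {y} x∈ y∈ with x ≟ y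
  ... | yes refl = trans (≡ᵇ-true {next x} refl) (sym (≡ᵇ-true {x} refl))
  ... | no  x≢y  = trans (≡ᵇ-false (x≢y ∘ next-injective x∈ y∈)) (sym (≡ᵇ-false x≢y))

  elemᵇ-next : ∀ {occ} → InRange x → All InRange occ → elemᵇ (next x) (map next occ) ≡ elemᵇ x occ
  elemᵇ-next x∈ []          = refl
  elemᵇ-next x∈ (y∈ ∷ occ∈) rewrite ≡ᵇ-next x∈ y∈ | elemᵇ-next x∈ occ∈ = refl

  search-next : ∀ k {occ} → InRange p → All InRange occ →
    search k (map next occ) (next p) ≡ Maybe.map next (search k occ p)
  search-next zero    p∈ occ∈ = refl
  search-next {p} (suc k) {occ} p∈ occ∈ rewrite elemᵇ-next p∈ occ∈ with elemᵇ p occ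
  ... | true  = search-next k (next-inRange p∈) occ∈
  ... | false = refl

  park-next : ∀ {occ} → InRange p → All InRange occ → park (map next occ) (next p) ≡ map next (park occ p)
  park-next {p} {occ} p∈ occ∈ rewrite search-next m p∈ occ∈ with search m occ p
  ... | nothing = refl
  ... | just s  = refl

  circLucky-next : ∀ {occ} ps → All InRange occ → All InRange ps →
    circLucky (map next occ) (map next ps) ≡ circLucky occ ps
  circLucky-next []       occ∈ []          = refl
  circLucky-next {occ} (p ∷ ps) occ∈ (p∈ ∷ ps∈) rewrite elemᵇ-next p∈ occ∈ | park-next p∈ occ∈ =
    cong (_+_ (𝟙 (isVacant occ p))) (circLucky-next ps (park-inRange p∈ occ∈) ps∈)

  circLucky-rotate : ∀ r ps → All InRange ps → circLucky [] (map (rotate r) ps) ≡ circLucky [] ps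
  circLucky-rotate zero    ps ps∈ = cong (circLucky []) (map-id ps)
  circLucky-rotate (suc r) ps ps∈ =
    begin
      circLucky [] (map (rotate r ∘ next) ps)
        ≡⟨ cong (circLucky []) (map-∘ ps) ⟩
      circLucky [] (map (rotate r) (map next ps))
        ≡⟨ circLucky-rotate r (map next ps) (map⁺ (All.map next-inRange ps∈)) ⟩
      circLucky [] (map next ps)
        ≡⟨ circLucky-next ps [] ps∈ ⟩
      circLucky [] ps
        ∎
    where open ≡-Reasoning

  vacancies-park : ∀ occ → InRange p → vacancies (park occ p) m ≡ vacancies occ m ∸ 1
  vacancies-park {p} occ p∈ with search m occ p in eq
  ... | nothing = trans full (cong (_∸ 1) (sym full))
    where
      occupied : ∀ {x} → 1 ≤ x → x ≤ m → Occupied occ x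
      occupied 1≤x x≤m with rotate-reaches p∈ (1≤x , x≤m)
      ... | j , j<m , refl = search-nothing m eq j<m
      full : vacancies occ m ≡ 0
      full = vacancies-full occ m occupied
  ... | just s with search-just m eq
  ...   | j , refl , vacant = cong (_∸ 1) (vacancies-∷ occ (proj₁ s∈) (proj₂ s∈) vacant)
    where
      s∈ : InRange (rotate j p)
      s∈ = rotate-inRange j p∈

  module _ (u : ℤ) where

    vacancyFactor : ℕ → ℤ
    vacancyFactor v = + (m ∸ v) ℤ.+ + v ℤ.* u

    vacancyProduct : ℕ → ℕ → ℤ
    vacancyProduct zero    v = + 1
    vacancyProduct (suc k) v = vacancyFactor v ℤ.* vacancyProduct k (v ∸ 1)

    sumWords-circLucky : ∀ k occ →
      sumWords m k (λ ps → u ℤ.^ circLucky occ ps) ≡ vacancyProduct k (vacancies occ m)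
    sumWords-circLucky zero    occ = refl
    sumWords-circLucky (suc k) occ =
      begin
        sumRange m (λ a → sumWords m k (λ ps → u ℤ.^ (𝟙 (isVacant occ a) + circLucky (park occ a) ps)))
      ≡⟨ sumRange-cong m (λ {a} 1≤a a≤m → step a (1≤a , a≤m)) ⟩
        sumRange m (λ a → u ℤ.^ 𝟙 (isVacant occ a) ℤ.* vacancyProduct k (vacancies occ m ∸ 1))
      ≡⟨ sum-map-*ʳ _ _ (range 1 m) ⟩
        sumRange m (λ a → u ℤ.^ 𝟙 (isVacant occ a)) ℤ.* vacancyProduct k (vacancies occ m ∸ 1)
      ≡⟨ cong (ℤ._* vacancyProduct k (vacancies occ m ∸ 1)) (sumRange-vacant u occ m) ⟩
        vacancyProduct (suc k) (vacancies occ m)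
      ∎
      where
        open ≡-Reasoning
        step : ∀ a → InRange a →
          sumWords m k (λ ps → u ℤ.^ (𝟙 (isVacant occ a) + circLucky (park occ a) ps)) ≡
          u ℤ.^ 𝟙 (isVacant occ a) ℤ.* vacancyProduct k (vacancies occ m ∸ 1)
        step a a∈ =
          begin
            sumWords m k (λ ps → u ℤ.^ (𝟙 (isVacant occ a) + circLucky (park occ a) ps))
          ≡⟨ sumWords-cong m k (λ ps _ _ → ℤ.^-distribˡ-+-* u (𝟙 (isVacant occ a)) (circLucky (park occ a) ps)) ⟩
            sumWords m k (λ ps → u ℤ.^ 𝟙 (isVacant occ a) ℤ.* u ℤ.^ circLucky (park occ a) ps)
          ≡⟨ sumWords-*ˡ m k (u ℤ.^ 𝟙 (isVacant occ a)) (λ ps → u ℤ.^ circLucky (park occ a) ps) ⟩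
            u ℤ.^ 𝟙 (isVacant occ a) ℤ.* sumWords m k (λ ps → u ℤ.^ circLucky (park occ a) ps)
          ≡⟨ cong (ℤ._*_ (u ℤ.^ 𝟙 (isVacant occ a)))
                  (trans (sumWords-circLucky k (park occ a)) (cong (vacancyProduct k) (vacancies-park occ a∈))) ⟩
            u ℤ.^ 𝟙 (isVacant occ a) ℤ.* vacancyProduct k (vacancies occ m ∸ 1)
          ∎

    vacancyProduct-range : ∀ j c →
      vacancyProduct j (m ∸ c) ≡ productℤ (map (λ i → vacancyFactor (m ∸ i)) (applyUpTo (_+_ c) j))
    vacancyProduct-range zero    c = refl
    vacancyProduct-range (suc j) c =
      cong₂ ℤ._*_ (cong (vacancyFactor ∘ (m ∸_)) (sym (+-identityʳ c)))
                  (trans (cong (vacancyProduct j) (trans (∸-+-assoc m c 1) (cong (m ∸_) (+-comm c 1))))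
                         (trans (vacancyProduct-range j (suc c))
                                (cong (productℤ ∘ map (λ i → vacancyFactor (m ∸ i)))
                                      (applyUpTo-cong j (λ i → sym (+-suc c i))))))

sumRange-next : ∀ m (f : ℕ → ℤ) → sumRange m (f ∘ Circular.next m) ≡ sumRange m f
sumRange-next zero    f = refl
sumRange-next (suc k) f =
  begin
    sumRange (suc k) (f ∘ next)                   ≡⟨ sumRange-suc k _ ⟩
    sumRange k (f ∘ next) ℤ.+ f (next (suc k))    ≡⟨ cong₂ ℤ._+_ (sumRange-cong k (λ _ a≤k → cong f (next-< (s≤s a≤k))))
                                                                  (cong f (next-≥ ≤-refl)) ⟩
    sumRange k (f ∘ suc) ℤ.+ f 1                  ≡⟨ ℤ.+-comm _ (f 1) ⟩
    f 1 ℤ.+ sumRange k (f ∘ suc)                  ≡⟨ cong (ℤ._+_ (f 1) ∘ sumℤ) (trans (map-applyUpTo suc (f ∘ suc) k)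
                                                                                      (sym (map-applyUpTo (suc ∘ suc) f k))) ⟩
    sumRange (suc k) f                            ∎
  where
    open ≡-Reasoning
    open Circular (suc k)

sumRange-rotate : ∀ m r (f : ℕ → ℤ) → sumRange m (f ∘ Circular.rotate m r) ≡ sumRange m f
sumRange-rotate m zero    f = refl
sumRange-rotate m (suc r) f = trans (sumRange-next m (f ∘ Circular.rotate m r)) (sumRange-rotate m r f)

-- Prime parking functions park circularly

module LinearAsCircular (m : ℕ) where
  open Circular m

  -- The invariant that keeps the cars of a prime parking function from wrapping around;
  -- for the empty lot it is primality itself.
  Crowded : List ℕ → List ℕ → Set
  Crowded occ ps = ∀ {q} → 1 ≤ q → q ≤ m → Vacant occ q → vacancies occ q < count (_≤ᵇ q) ps

  crowded-≤ : ∀ {occ ps} → Crowded occ (p ∷ ps) → p ≤ q → 1 ≤ q → q ≤ m → Vacant occ q →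
    vacancies occ q ≤ count (_≤ᵇ q) ps
  crowded-≤ {p} {q} {occ} {ps} crowded p≤q 1≤q q≤m vacant =
    s≤s⁻¹ (subst (λ β → vacancies occ q < 𝟙 β + count (_≤ᵇ q) ps) (≤ᵇ-true p≤q) (crowded 1≤q q≤m vacant))

  crowded-> : ∀ {occ ps} → Crowded occ (p ∷ ps) → q < p → 1 ≤ q → q ≤ m → Vacant occ q →
    vacancies occ q < count (_≤ᵇ q) ps
  crowded-> {p} {q} {occ} {ps} crowded q<p 1≤q q≤m vacant =
    subst (λ β → vacancies occ q < 𝟙 β + count (_≤ᵇ q) ps) (≤ᵇ-false q<p) (crowded 1≤q q≤m vacant)

  crowded-step : ∀ {occ ps} → FirstVacant occ p s → 1 ≤ p → Crowded occ (p ∷ ps) → Crowded (s ∷ occ) ps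
  crowded-step {p} {s} {occ} {ps} first 1≤p crowded {q} 1≤q q≤m vacant′ with p ≤? q
  ... | yes p≤q = subst (_≤ count (_≤ᵇ q) ps) (sym fewer) (crowded-≤ {ps = ps} crowded p≤q 1≤q q≤m vacant)
    where
      vacant : Vacant occ q
      vacant = vacant-∷⁻ {s = s} {x = q} {occ = occ} vacant′
      s≤q : s ≤ q
      s≤q = ≮⇒≥ (λ q<s → occupied⇒¬vacant {q} {occ} (firstVacant-before first p≤q q<s) vacant)
      fewer : suc (vacancies (s ∷ occ) q) ≡ vacancies occ q
      fewer = vacancies-∷ occ (≤-trans 1≤p (firstVacant-≤ first)) s≤q (firstVacant-vacant first)
  ... | no  p≰q =
    subst (_< count (_≤ᵇ q) ps) (sym same) (crowded-> {ps = ps} crowded (≰⇒> p≰q) 1≤q q≤m vacant)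
    where
      same : vacancies (s ∷ occ) q ≡ vacancies occ q
      same = vacancies-∷-< occ (<-≤-trans (≰⇒> p≰q) (firstVacant-≤ first))
      vacant : Vacant occ q
      vacant = vacant-∷⁻ {s = s} {x = q} {occ = occ} vacant′

  full⇒noVacancy : ∀ {occ ps} → Crowded occ (p ∷ ps) → suc (length ps) ≡ vacancies occ (suc m) →
    (∀ {t} → p ≤ t → t ≤ m → Occupied occ t) → vacancies occ m ≡ 0
  full⇒noVacancy {p} {occ} {ps} crowded len full = n<1⇒n≡0 (≰⇒> impossible)
    where
      impossible : ¬ 1 ≤ vacancies occ m
      impossible 1≤v with lastVacant occ m 1≤v
      ... | q , 1≤q , q≤m , vacant , same = <-irrefl refl (begin-strict
          vacancies occ q      <⟨ crowded-> {ps = ps} crowded q<p 1≤q q≤m vacant ⟩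
          count (_≤ᵇ q) ps     ≤⟨ count≤length _ ps ⟩
          length ps            ≤⟨ s≤s⁻¹ (begin
            suc (length ps)            ≡⟨ len ⟩
            vacancies occ (suc m)      ≤⟨ +-monoˡ-≤ (vacancies occ m) (𝟙≤1 _) ⟩
            suc (vacancies occ m)      ≡⟨ cong suc (sym same) ⟩
            suc (vacancies occ q)      ∎) ⟩
          vacancies occ q      ∎)
        where
          open ≤-Reasoning
          q<p : q < p
          q<p = ≰⇒> (λ p≤q → occupied⇒¬vacant {q} {occ} (full p≤q q≤m) vacant)

  full⇒lastCar : ∀ {occ ps} → Crowded occ (p ∷ ps) → suc (length ps) ≡ vacancies occ (suc m) →
    (∀ {t} → p ≤ t → t ≤ m → Occupied occ t) → p ≤ m → ps ≡ [] × FirstVacant occ p (suc m)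
  full⇒lastCar {p} {occ} {ps} crowded len full p≤m with length≡𝟙 ps (isVacant occ (suc m)) len′
    where
      len′ : suc (length ps) ≡ 𝟙 (isVacant occ (suc m))
      len′ = trans len (trans (cong (_+_ _) (full⇒noVacancy {occ = occ} {ps = ps} crowded len full))
                              (+-identityʳ _))
  ... | refl , vacant =
    refl , firstVacant-after-full (≤⇒≤‴ (m≤n⇒m≤1+n p≤m)) (λ p≤t t<1+m → full p≤t (s≤s⁻¹ t<1+m))
                                  (isVacant⇒Vacant {suc m} {occ} vacant)

  -- Only the last car finds 1, …, m full; it then parks on m + 1 in the lot and nowhere in
  -- the circle, unlucky both times.
  crowded⇒circular : ∀ occ ps → All InRange ps → Crowded occ ps → length ps ≡ vacancies occ (suc m) →
    luckyFrom (suc m) occ ps ≡ circLucky occ ps × allParkFrom (suc m) occ ps ≡ true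
  crowded⇒circular occ []       _                   _       _   = refl , refl
  crowded⇒circular occ (p ∷ ps) ((1≤p , p≤m) ∷ ps∈) crowded len
    with firstVacant-or-full occ m (≤⇒≤‴ (m≤n⇒m≤1+n p≤m))
  ... | inj₁ (s , first , s≤m) = sameLucky , trans (allParkFrom-firstVacant ps first (m≤n⇒m≤1+n s≤m)) (proj₂ rest)
    where
      fewer : suc (vacancies (s ∷ occ) (suc m)) ≡ vacancies occ (suc m)
      fewer = vacancies-∷ occ (≤-trans 1≤p (firstVacant-≤ first)) (m≤n⇒m≤1+n s≤m) (firstVacant-vacant first)
      rest : luckyFrom (suc m) (s ∷ occ) ps ≡ circLucky (s ∷ occ) ps × allParkFrom (suc m) (s ∷ occ) ps ≡ true
      rest = crowded⇒circular (s ∷ occ) ps ps∈ (crowded-step {ps = ps} first 1≤p crowded)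
                              (suc-injective (trans len (sym fewer)))
      sameLucky : luckyFrom (suc m) occ (p ∷ ps) ≡ circLucky occ (p ∷ ps)
      sameLucky = begin
        luckyFrom (suc m) occ (p ∷ ps)                       ≡⟨ luckyFrom-firstVacant ps first (m≤n⇒m≤1+n s≤m) ⟩
        𝟙 (isVacant occ p) + luckyFrom (suc m) (s ∷ occ) ps  ≡⟨ cong (_+_ (𝟙 (isVacant occ p))) (proj₁ rest) ⟩
        𝟙 (isVacant occ p) + circLucky (s ∷ occ) ps          ≡⟨ cong (λ occ′ → 𝟙 (isVacant occ p) + circLucky occ′ ps)
                                                                     (sym (park-firstVacant first 1≤p s≤m)) ⟩
        circLucky occ (p ∷ ps)                               ∎
        where open ≡-Reasoning
  ... | inj₂ full with full⇒lastCar {occ = occ} {ps = ps} crowded len full p≤m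
  ...   | refl , first = luckyFrom-firstVacant [] first ≤-refl , allParkFrom-firstVacant [] first ≤-refl

-- The cycle lemma

record IsLastMinimum (E : ℕ → ℕ) (m t : ℕ) : Set where
  field
    positive : 1 ≤ t
    bounded  : t ≤ m
    minimal  : ∀ {j} → 1 ≤ j → j ≤ m → E t ≤ E j
    later    : ∀ {j} → t < j → j ≤ m → E t < E j

lastMinimum : ∀ E m .{{_ : NonZero m}} → ∃[ t ] IsLastMinimum E m t
lastMinimum E 1 = 1 , record
  { positive = ≤-refl
  ; bounded  = ≤-refl
  ; minimal  = λ 1≤j j≤1 → ≤-reflexive (cong E (≤-antisym 1≤j j≤1))
  ; later    = λ 1<j j≤1 → ⊥-elim (<⇒≱ 1<j j≤1)
  }
lastMinimum E (suc (suc k)) with lastMinimum E (suc k)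
... | t , isMin with E (suc (suc k)) ≤? E t
...   | yes new≤ = suc (suc k) , record
  { positive = s≤s z≤n
  ; bounded  = ≤-refl
  ; minimal  = minimal
  ; later    = λ 2+k<j j≤2+k → ⊥-elim (<⇒≱ 2+k<j j≤2+k)
  }
  where
    minimal : ∀ {j} → 1 ≤ j → j ≤ suc (suc k) → E (suc (suc k)) ≤ E j
    minimal 1≤j j≤2+k with m≤n⇒m<n∨m≡n j≤2+k
    ... | inj₁ j<2+k = ≤-trans new≤ (IsLastMinimum.minimal isMin 1≤j (s≤s⁻¹ j<2+k))
    ... | inj₂ refl  = ≤-refl
...   | no  new≰ = t , record
  { positive = IsLastMinimum.positive isMin
  ; bounded  = m≤n⇒m≤1+n (IsLastMinimum.bounded isMin)
  ; minimal  = minimal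
  ; later    = later
  }
  where
    minimal : ∀ {j} → 1 ≤ j → j ≤ suc (suc k) → E t ≤ E j
    minimal 1≤j j≤2+k with m≤n⇒m<n∨m≡n j≤2+k
    ... | inj₁ j<2+k = IsLastMinimum.minimal isMin 1≤j (s≤s⁻¹ j<2+k)
    ... | inj₂ refl  = <⇒≤ (≰⇒> new≰)
    later : ∀ {j} → t < j → j ≤ suc (suc k) → E t < E j
    later t<j j≤2+k with m≤n⇒m<n∨m≡n j≤2+k
    ... | inj₁ j<2+k = IsLastMinimum.later isMin t<j (s≤s⁻¹ j<2+k)
    ... | inj₂ refl  = ≰⇒> new≰

lastMinimum-≮ : ∀ {E} → IsLastMinimum E m s → IsLastMinimum E m t → ¬ s < t
lastMinimum-≮ isMin₁ isMin₂ s<t =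
  <⇒≱ (IsLastMinimum.later isMin₁ s<t (IsLastMinimum.bounded isMin₂))
      (IsLastMinimum.minimal isMin₂ (IsLastMinimum.positive isMin₁) (IsLastMinimum.bounded isMin₁))

lastMinimum-unique : ∀ {E} → IsLastMinimum E m s → IsLastMinimum E m t → s ≡ t
lastMinimum-unique isMin₁ isMin₂ =
  ≤-antisym (≮⇒≥ (lastMinimum-≮ isMin₂ isMin₁)) (≮⇒≥ (lastMinimum-≮ isMin₁ isMin₂))

-- Write t + r = m. The rotation by r moves the spots t + 1, …, m to 1, …, r, so its prefix
-- counts D r i are differences of the prefix counts C of g (D-split, D-wrap). It exceeds the
-- diagonal exactly when t is the last minimum of the walk C x − x, shifted to E x ≥ 0.
module CycleLemma (m : ℕ) (g : List ℕ) (g∈ : All (Circular.InRange m) g) (|g| : length g ≡ suc m) where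
  open Circular m

  C : ℕ → ℕ
  C j = count (_≤ᵇ j) g

  D : ℕ → ℕ → ℕ
  D r i = cumB (map (rotate r) g) i

  E : ℕ → ℕ
  E x = C x + (m ∸ x)

  ≤ᵇ-rotate : t + r ≡ m → i ≤ m → InRange x →
    𝟙 (rotate r x ≤ᵇ i) + 𝟙 (x ≤ᵇ t) ≡ 𝟙 (x ≤ᵇ i ∸ r) + 𝟙 (x ≤ᵇ t + i)
  ≤ᵇ-rotate {t} {r} {i} {x} refl i≤m (1≤x , x≤m) with x ≤? t
  ... | yes x≤t rewrite ≤ᵇ-true x≤t | ≤ᵇ-true (≤-trans x≤t (m≤m+n t i)) | rotate-+ r (+-monoˡ-≤ r x≤t) =
    cong (λ β → 𝟙 β + 1) (≤ᵇ-≡ (m+n≤o⇒m≤o∸n x) (λ x≤i∸r → m≤o∸n⇒m+n≤o x (r≤i x≤i∸r) x≤i∸r))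
    where
      r≤i : x ≤ i ∸ r → r ≤ i
      r≤i x≤i∸r = ≮⇒≥ (λ i<r → <⇒≱ 1≤x (≤-trans x≤i∸r (≤-reflexive (m≤n⇒m∸n≡0 (<⇒≤ i<r)))))
  ... | no  x≰t
    rewrite ≤ᵇ-false (≰⇒> x≰t)
          | ≤ᵇ-false {x} {i ∸ r} (≤-<-trans (≤-trans (∸-monoˡ-≤ r i≤m) (≤-reflexive (m+n∸n≡m t r))) (≰⇒> x≰t))
          | rotate-wrap r x≤m (m≤n+m r t) (+-monoˡ-< r (≰⇒> x≰t))
          | trans (cong₂ _∸_ (+-comm x r) (+-comm t r)) ([m+n]∸[m+o]≡n∸o r x t) =
    trans (+-identityʳ _)
          (cong 𝟙 (≤ᵇ-≡ (λ x∸t≤i → ≤-trans (m≤n+m∸n x t) (+-monoʳ-≤ t x∸t≤i)) (m≤n+o⇒m∸n≤o x t)))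

  C-zero : C 0 ≡ 0
  C-zero = count-none _ g (All.map (λ x∈ → ≤ᵇ-false (proj₁ x∈)) g∈)

  C-full : m ≤ j → C j ≡ suc m
  C-full m≤j = trans (count-all _ g (All.map (λ x∈ → ≤ᵇ-true (≤-trans (proj₂ x∈) m≤j)) g∈)) |g|

  count-rotate : t + r ≡ m → i ≤ m → D r i + C t ≡ C (i ∸ r) + C (t + i)
  count-rotate {t} {r} {i} t+r≡m i≤m =
    trans (cong (_+ C t) (cumB-map (rotate r) g i)) (count-+-pointwise _ _ _ _ g g∈ (≤ᵇ-rotate t+r≡m i≤m))

  D-split : t + r ≡ m → t + i ≤ m → D r i + C t ≡ C (t + i)
  D-split {t} {r} {i} t+r≡m t+i≤m =
    trans (count-rotate t+r≡m (≤-trans (m≤n+m i t) t+i≤m))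
          (cong (_+ C (t + i)) (trans (cong C (m≤n⇒m∸n≡0 i≤r)) C-zero))
    where
      i≤r : i ≤ r
      i≤r = +-cancelˡ-≤ t i r (≤-trans t+i≤m (≤-reflexive (sym t+r≡m)))

  D-wrap : t + r ≡ m → i ≤ m → j + m ≡ t + i → D r i + C t ≡ C j + suc m
  D-wrap {t} {r} {i} {j} t+r≡m i≤m j+m≡t+i =
    trans (count-rotate t+r≡m i≤m)
          (cong₂ _+_ (cong C i∸r≡j) (C-full (≤-trans (m≤n+m m j) (≤-reflexive j+m≡t+i))))
    where
      j+r≡i : j + r ≡ i
      j+r≡i = +-cancelˡ-≡ t (j + r) i (begin
        t + (j + r) ≡⟨ +-comm t (j + r) ⟩
        j + r + t   ≡⟨ +-assoc j r t ⟩
        j + (r + t) ≡⟨ cong (_+_ j) (trans (+-comm r t) t+r≡m) ⟩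
        j + m       ≡⟨ j+m≡t+i ⟩
        t + i       ∎)
        where open ≡-Reasoning
      i∸r≡j : i ∸ r ≡ j
      i∸r≡j = trans (cong (_∸ r) (sym j+r≡i)) (m+n∸n≡m j r)

  E-shift : x ≤ m → E x + x ≡ C x + m
  E-shift {x} x≤m = trans (+-assoc (C x) (m ∸ x) x) (cong (_+_ (C x)) (m∸n+n≡m x≤m))

  split-left : t ≤ m → i + (C t + m) ≡ E t + (t + i)
  split-left {t} {i} t≤m = begin
    i + (C t + m)  ≡⟨ +-comm i (C t + m) ⟩
    C t + m + i    ≡⟨ cong (_+ i) (sym (E-shift t≤m)) ⟩
    E t + t + i    ≡⟨ +-assoc (E t) t i ⟩
    E t + (t + i)  ∎
    where open ≡-Reasoning

  split-right : t + r ≡ m → t + i ≤ m → D r i + (C t + m) ≡ E (t + i) + (t + i)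
  split-right {t} {r} {i} t+r≡m t+i≤m = begin
    D r i + (C t + m)    ≡⟨ sym (+-assoc (D r i) (C t) m) ⟩
    D r i + C t + m      ≡⟨ cong (_+ m) (D-split t+r≡m t+i≤m) ⟩
    C (t + i) + m        ≡⟨ sym (E-shift t+i≤m) ⟩
    E (t + i) + (t + i)  ∎
    where open ≡-Reasoning

  wrap-left : t ≤ m → j + m ≡ t + i → suc i + (C t + m) ≡ suc (E t + (j + m))
  wrap-left {t} t≤m j+m≡t+i = cong suc (trans (split-left t≤m) (cong (_+_ (E t)) (sym j+m≡t+i)))

  wrap-right : t + r ≡ m → i ≤ m → j ≤ m → j + m ≡ t + i → D r i + (C t + m) ≡ suc (E j + (j + m))
  wrap-right {t} {r} {i} {j} t+r≡m i≤m j≤m j+m≡t+i = begin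
    D r i + (C t + m)    ≡⟨ sym (+-assoc (D r i) (C t) m) ⟩
    D r i + C t + m      ≡⟨ cong (_+ m) (D-wrap t+r≡m i≤m j+m≡t+i) ⟩
    C j + suc m + m      ≡⟨ cong (_+ m) (+-suc (C j) m) ⟩
    suc (C j + m + m)    ≡⟨ cong (λ z → suc (z + m)) (sym (E-shift j≤m)) ⟩
    suc (E j + j + m)    ≡⟨ cong suc (+-assoc (E j) j m) ⟩
    suc (E j + (j + m))  ∎
    where open ≡-Reasoning

  lastMinimum⇒exceeds : t + r ≡ m → IsLastMinimum E m t → Exceeds m (map (rotate r) g)
  lastMinimum⇒exceeds {t} {r} t+r≡m isMin {i} 1≤i i≤m with t + i ≤? m
  ... | yes t+i≤m =
    +-cancelʳ-< (C t + m) i (D r i)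
      (subst₂ _<_ (sym (split-left t≤m)) (sym (split-right t+r≡m t+i≤m))
              (+-monoˡ-< (t + i) (IsLastMinimum.later isMin (m<m+n t 1≤i) t+i≤m)))
    where
      t≤m : t ≤ m
      t≤m = IsLastMinimum.bounded isMin
  ... | no  t+i≰m =
    +-cancelʳ-≤ (C t + m) (suc i) (D r i)
      (subst₂ _≤_ (sym (wrap-left t≤m j₀+m≡t+i)) (sym (wrap-right t+r≡m i≤m j₀≤m j₀+m≡t+i))
              (s≤s (+-monoˡ-≤ (j₀ + m) (IsLastMinimum.minimal isMin 1≤j₀ j₀≤m))))
    where
      t≤m : t ≤ m
      t≤m = IsLastMinimum.bounded isMin
      j₀ : ℕ
      j₀ = t + i ∸ m
      j₀+m≡t+i : j₀ + m ≡ t + i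
      j₀+m≡t+i = m∸n+n≡m (<⇒≤ (≰⇒> t+i≰m))
      1≤j₀ : 1 ≤ j₀
      1≤j₀ = m<n⇒0<n∸m (≰⇒> t+i≰m)
      j₀≤m : j₀ ≤ m
      j₀≤m = ≤-trans (+-cancelʳ-≤ m j₀ t (subst (_≤ t + m) (sym j₀+m≡t+i) (+-monoʳ-≤ t i≤m))) t≤m

  exceeds⇒lastMinimum : t + r ≡ m → 1 ≤ t → Exceeds m (map (rotate r) g) → IsLastMinimum E m t
  exceeds⇒lastMinimum {t} {r} t+r≡m 1≤t prime = record
    { positive = 1≤t
    ; bounded  = t≤m
    ; minimal  = minimal
    ; later    = later
    }
    where
      t≤m : t ≤ m
      t≤m = ≤-trans (m≤m+n t r) (≤-reflexive t+r≡m)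
      later : ∀ {j} → t < j → j ≤ m → E t < E j
      later {j} t<j j≤m =
        subst (λ s → E t < E s) t+i≡j
          (+-cancelʳ-< (t + i₀) (E t) (E (t + i₀))
            (subst₂ _<_ (split-left t≤m) (split-right t+r≡m (subst (_≤ m) (sym t+i≡j) j≤m))
                    (+-monoˡ-< (C t + m) (prime 1≤i (≤-trans (m∸n≤m j t) j≤m)))))
        where
          i₀ : ℕ
          i₀ = j ∸ t
          t+i≡j : t + i₀ ≡ j
          t+i≡j = m+[n∸m]≡n (<⇒≤ t<j)
          1≤i : 1 ≤ i₀
          1≤i = m<n⇒0<n∸m t<j
      minimal : ∀ {j} → 1 ≤ j → j ≤ m → E t ≤ E j
      minimal {j} 1≤j j≤m with t <? j
      ... | yes t<j = <⇒≤ (later t<j j≤m)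
      ... | no  t≮j =
        +-cancelʳ-≤ (j + m) (E t) (E j)
          (s≤s⁻¹ (subst₂ _≤_ (wrap-left t≤m j+m≡t+i) (wrap-right t+r≡m i≤m j≤m j+m≡t+i)
                         (+-monoˡ-≤ (C t + m) (prime 1≤i i≤m))))
        where
          t<j+m : t < j + m
          t<j+m = ≤-<-trans t≤m (m<n+m m 1≤j)
          i₀ : ℕ
          i₀ = j + m ∸ t
          j+m≡t+i : j + m ≡ t + i₀
          j+m≡t+i = sym (m+[n∸m]≡n (<⇒≤ t<j+m))
          1≤i : 1 ≤ i₀
          1≤i = m<n⇒0<n∸m t<j+m
          i≤m : i₀ ≤ m
          i≤m = m≤n+o⇒m∸n≤o (j + m) t (+-monoˡ-≤ m (≮⇒≥ t≮j))

  exactlyOneExceedingRotation : .{{_ : NonZero m}} →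
    ∃[ r₀ ] r₀ < m × Exceeds m (map (rotate r₀) g) × (∀ {r} → r < m → Exceeds m (map (rotate r) g) → r ≡ r₀)
  exactlyOneExceedingRotation with lastMinimum E m
  ... | t₀ , isMin = m ∸ t₀ , r₀<m , lastMinimum⇒exceeds t₀+r₀≡m isMin , unique
    where
      t₀+r₀≡m : t₀ + (m ∸ t₀) ≡ m
      t₀+r₀≡m = m+[n∸m]≡n (IsLastMinimum.bounded isMin)
      r₀<m : m ∸ t₀ < m
      r₀<m = ∸-monoʳ-< (IsLastMinimum.positive isMin) (IsLastMinimum.bounded isMin)
      unique : ∀ {r} → r < m → Exceeds m (map (rotate r) g) → r ≡ m ∸ t₀
      unique {r} r<m prime = trans (sym (m∸[m∸n]≡n (<⇒≤ r<m))) (cong (m ∸_) t≡t₀)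
        where
          t≡t₀ : m ∸ r ≡ t₀
          t≡t₀ = lastMinimum-unique (exceeds⇒lastMinimum (m∸n+n≡m (<⇒≤ r<m)) (m<n⇒0<n∸m r<m) prime) isMin

  sumBelow-rotations : .{{_ : NonZero m}} → ∀ W →
    sumBelow m (λ r → + 𝟙 (exceedsᵇ m (map (rotate r) g)) ℤ.* W) ≡ W
  sumBelow-rotations W with exactlyOneExceedingRotation
  ... | r₀ , r₀<m , prime₀ , unique =
    trans (sumBelow-single m r₀ r₀<m vanish)
          (trans (cong (λ β → + 𝟙 β ℤ.* W) (exceedsᵇ-true m (map (rotate r₀) g) prime₀)) (ℤ.*-identityˡ W))
    where
      vanish : ∀ {r} → r < m → r ≢ r₀ → + 𝟙 (exceedsᵇ m (map (rotate r) g)) ℤ.* W ≡ + 0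
      vanish {r} r<m r≢r₀ =
        trans (cong (λ β → + 𝟙 β ℤ.* W) (exceedsᵇ-false m (map (rotate r) g) (r≢r₀ ∘ unique r<m))) (ℤ.*-zeroˡ W)

luckyGF-sumWords : ∀ n u → luckyGF n u ≡ sumWords (suc n) n (λ f → if isPrime n f then u ℤ.^ lucky n f else + 0)
luckyGF-sumWords n u = trans (sum-map-filter (isPrime n) (λ f → u ℤ.^ lucky n f) (prefs n)) (sum-seqs (suc n) n _)

module LuckyGF (m : ℕ) .{{_ : NonZero m}} (u : ℤ) where
  open Circular m
  open LinearAsCircular m

  weight : List ℕ → ℤ
  weight f = if isPrime (suc m) f then u ℤ.^ lucky (suc m) f else + 0

  prime⇒bounded : ∀ f → length f ≡ suc m → isPrime (suc m) f ≡ true → All (_≤ m) f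
  prime⇒bounded f |f| prime =
    All.map (≤ᵇ⇒≤ _ m) (length≤count⇒all (_≤ᵇ m) f (subst (_≤ count (_≤ᵇ m) f) (sym |f|) m<count))
    where
      m<count : m < count (_≤ᵇ m) f
      m<count = subst (m <_) (length-filter≡count (_≤ᵇ m) f)
                      (exceedsᵇ⇒Exceeds m f (∧-conicalʳ (isParking (suc m) f) _ prime) (>-nonZero⁻¹ m) ≤-refl)

  weight-unbounded : ∀ f → length f ≡ suc m → Any (m <_) f → weight f ≡ + 0
  weight-unbounded f |f| big with isPrime (suc m) f in prime
  ... | true  = ⊥-elim (All¬⇒¬Any (All.map ≤⇒≯ (prime⇒bounded f |f| prime)) big)
  ... | false = refl

  -- The left side is weight w, unfolded so that the with-abstraction on exceedsᵇ m w reaches it.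
  weight-circular : ∀ w → All InRange w → length w ≡ suc m →
    (if isParking (suc m) w ∧ exceedsᵇ m w then u ℤ.^ lucky (suc m) w else + 0) ≡
    + 𝟙 (exceedsᵇ m w) ℤ.* u ℤ.^ circLucky [] w
  weight-circular w w∈ |w| with exceedsᵇ m w in holds
  ... | false = trans (cong (λ β → if β then u ℤ.^ lucky (suc m) w else + 0) (∧-zeroʳ (isParking (suc m) w)))
                      (sym (ℤ.*-zeroˡ (u ℤ.^ circLucky [] w)))
  ... | true  =
    begin
      (if isParking (suc m) w ∧ true then u ℤ.^ lucky (suc m) w else + 0)
    ≡⟨ cong (λ β → if β ∧ true then u ℤ.^ lucky (suc m) w else + 0) (proj₂ circular) ⟩
      u ℤ.^ lucky (suc m) w
    ≡⟨ cong (u ℤ.^_) (proj₁ circular) ⟩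
      u ℤ.^ circLucky [] w
    ≡⟨ sym (ℤ.*-identityˡ _) ⟩
      + 1 ℤ.* u ℤ.^ circLucky [] w
    ∎
    where
      open ≡-Reasoning
      crowded : Crowded [] w
      crowded {q} 1≤q q≤m _ =
        subst₂ _<_ (sym (vacancies-[] q)) (length-filter≡count (_≤ᵇ q) w) (exceedsᵇ⇒Exceeds m w holds 1≤q q≤m)
      circular : lucky (suc m) w ≡ circLucky [] w × isParking (suc m) w ≡ true
      circular = crowded⇒circular [] w w∈ crowded (trans |w| (sym (vacancies-[] (suc m))))

  primeSum : ℤ
  primeSum = sumWords m (suc m) (λ w → + 𝟙 (exceedsᵇ m w) ℤ.* u ℤ.^ circLucky [] w)

  luckyGF≡primeSum : luckyGF (suc m) u ≡ primeSum
  luckyGF≡primeSum = begin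
    luckyGF (suc m) u                      ≡⟨ luckyGF-sumWords (suc m) u ⟩
    sumWords (suc (suc m)) (suc m) weight  ≡⟨ sumWords-restrict (suc m) (m≤n+m m 2) weight-unbounded ⟩
    sumWords m (suc m) weight              ≡⟨ sumWords-cong m (suc m) weight-circular ⟩
    primeSum                               ∎
    where open ≡-Reasoning

  m*primeSum : + m ℤ.* primeSum ≡ vacancyProduct u (suc m) m
  m*primeSum = begin
    + m ℤ.* primeSum                                    ≡⟨ sym (sumBelow-const m primeSum) ⟩
    sumBelow m (λ _ → primeSum)                         ≡⟨ sumBelow-cong m (λ r → sym (rotated r)) ⟩
    sumBelow m (λ r → sumWords m (suc m) (summand r))   ≡⟨ sym (sumWords-sumBelow m (suc m) m summand) ⟩
    sumWords m (suc m) (λ w → sumBelow m (λ r → summand r w))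
      ≡⟨ sumWords-cong m (suc m) (λ w w∈ |w| →
           CycleLemma.sumBelow-rotations m w w∈ |w| (u ℤ.^ circLucky [] w)) ⟩
    sumWords m (suc m) (λ w → u ℤ.^ circLucky [] w)     ≡⟨ sumWords-circLucky u (suc m) [] ⟩
    vacancyProduct u (suc m) (vacancies [] m)           ≡⟨ cong (vacancyProduct u (suc m)) (vacancies-[] m) ⟩
    vacancyProduct u (suc m) m                          ∎
    where
      open ≡-Reasoning
      summand : ℕ → List ℕ → ℤ
      summand r w = + 𝟙 (exceedsᵇ m (map (rotate r) w)) ℤ.* u ℤ.^ circLucky [] w
      rotated : ∀ r → sumWords m (suc m) (summand r) ≡ primeSum
      rotated r =
        trans (sumWords-cong m (suc m) (λ w w∈ _ → cong (λ c → + 𝟙 (exceedsᵇ m (map (rotate r) w)) ℤ.* u ℤ.^ c)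
                                                         (sym (circLucky-rotate r w w∈))))
              (sumWords-map m (suc m) (rotate r) (sumRange-rotate m r)
                            (λ w → + 𝟙 (exceedsᵇ m w) ℤ.* u ℤ.^ circLucky [] w))

  vacancyFactor-complement : ∀ {i} → i ≤ m → vacancyFactor u (m ∸ i) ≡ + i ℤ.* + 1 ℤ.+ + (suc m ∸ i) ℤ.* u ℤ.+ - u
  vacancyFactor-complement {i} i≤m rewrite m∸[m∸n]≡n i≤m | +-∸-assoc 1 i≤m =
    solve 3 (λ a x v → a :+ x :* v := a :* con (+ 1) :+ (con (+ 1) :+ x) :* v :+ :- v) refl (+ i) (+ (m ∸ i)) u
    where open +-*-Solver

  complementProduct : ℤ
  complementProduct = productℤ (map (λ i → + i ℤ.* + 1 ℤ.+ + (suc m ∸ i) ℤ.* u ℤ.+ - u) (range 1 m))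

  vacancyProduct-full : vacancyProduct u (suc m) m ≡ + m ℤ.* (u ℤ.* complementProduct)
  vacancyProduct-full = begin
    vacancyFactor u m ℤ.* vacancyProduct u m (m ∸ 1)
      ≡⟨ cong₂ ℤ._*_ (trans (cong (λ z → + z ℤ.+ + m ℤ.* u) (n∸n≡0 m)) (ℤ.+-identityˡ (+ m ℤ.* u)))
                     (vacancyProduct-range u m 1) ⟩
    + m ℤ.* u ℤ.* productℤ (map (λ i → vacancyFactor u (m ∸ i)) (range 1 m))
      ≡⟨ cong (λ ps → + m ℤ.* u ℤ.* productℤ ps)
              (map-cong-local (All-range⁺ m (λ _ → vacancyFactor-complement))) ⟩
    + m ℤ.* u ℤ.* complementProduct
      ≡⟨ ℤ.*-assoc (+ m) u complementProduct ⟩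
    + m ℤ.* (u ℤ.* complementProduct)
      ∎
    where open ≡-Reasoning

  luckyGF-formula : luckyGF (suc m) u ≡ - P (suc m) (+ 1) u (- u)
  luckyGF-formula = begin
    luckyGF (suc m) u                ≡⟨ luckyGF≡primeSum ⟩
    primeSum                         ≡⟨ ℤ.*-cancelˡ-≡ (+ m) primeSum (u ℤ.* complementProduct)
                                                      (trans m*primeSum vacancyProduct-full) ⟩
    u ℤ.* complementProduct          ≡⟨ sym (ℤ.neg-involutive _) ⟩
    - - (u ℤ.* complementProduct)    ≡⟨ cong -_ (ℤ.neg-distribˡ-* u complementProduct) ⟩
    - (- u ℤ.* complementProduct)    ∎
    where open ≡-Reasoning

corollary10p3 : (n : ℕ) → n ≥ 1 → (u : ℤ) →
    luckyGF n u ≡ - P n (+ 1) u (- u)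
corollary10p3 1             _ u = solve 1 (λ v → v :* con (+ 1) :+ con (+ 0) := :- ((:- v) :* con (+ 1))) refl u
  where open +-*-Solver
corollary10p3 (suc (suc k)) _ u = LuckyGF.luckyGF-formula (suc k) u
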